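{- Let $z\ge 4$, $n \ge \ell(z)$ and $d$ be integers with $z+1 \le d < n/2$. Then $n^2 - dn + d^2 \le n^2 - zn + b(z)$.
   Context: A reachable pair of a digraph is an ordered pair $(\alpha,\beta)$ of (not necessarily distinct) vertices with a directed path (possibly of length $0$) from $\alpha$ to $\beta$; the weight of a digraph is its number of reachable pairs. $W(n)$ is the set of weights of digraphs on $n$ vertices, $b(n)$ is the largest integer such that every integer $k$ with $n\le k\le b(n)$ lies in $W(n)$, and $\ell(z) := b(z)-z+3$. -}

module Defs where

open import Data.Nat using (ℕ; _≤_)
open import Data.Bool using (Bool; T)
open import Data.Fin using (Fin)
open import Data.Product using (Σ; ∃; _×_; _,_)
open import Data.List using (List; length)
open import Data.List.Relation.Unary.Unique.Propositional using (Unique)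
open import Data.List.Membership.Propositional using (_∈_)
open import Function.Bundles using (_⇔_)
open import Relation.Binary.Construct.Closure.ReflexiveTransitive using (Star)
open import Relation.Binary.PropositionalEquality using (_≡_)

Digraph : ℕ → Set
Digraph n = Fin n → Fin n → Bool

Arc : ∀ {n} → Digraph n → Fin n → Fin n → Set
Arc E α β = T (E α β)

Reachable : ∀ {n} → Digraph n → Fin n → Fin n → Set
Reachable E = Star (Arc E)

HasWeight : ∀ {n} → Digraph n → ℕ → Set
HasWeight {n} E k =
  Σ (List (Fin n × Fin n)) λ S →
    Unique S × length S ≡ k ×
    (∀ α β → ((α , β) ∈ S) ⇔ Reachable E α β)

InW : ℕ → ℕ → Set
InW n k = ∃ λ (E : Digraph n) → HasWeight E k

IntervalInW : ℕ → ℕ → Set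
IntervalInW n b = ∀ k → n ≤ k → k ≤ b → InW n k

IsB : ℕ → ℕ → Set
IsB n b = IntervalInW n b × (∀ b' → IntervalInW n b' → b' ≤ b)

-- The theorem reduces to the lower bound b(z) ≥ z(z+1)/2 + z − 1 for z ≥ 4.
-- Placing F after E, with all arcs from E to F or none, realises the weights
-- w(E) + w(F) + |E||F| and w(E) + w(F); iterating this from complete digraphs
-- fills the whole interval [z, z(z+1)/2 + z − 1] with weights on z vertices.
-- Given that bound, n ≥ b(z) − z + 3 yields (z+1)² ≤ n + b(z), and since
-- d ↦ d² − dn decreases for d < n/2, d² − dn ≤ (z+1)² − (z+1)n ≤ b(z) − zn.
module Submission where

open import Defs
open import Data.Nat using (ℕ; zero; suc; _≤_; _<_; _+_; _*_; _∸_; z≤n; s≤s; s≤s⁻¹; _≤?_; _≟_)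
open import Data.Nat.Properties
open import Data.Nat.Tactic.RingSolver using (solve-∀)
open import Data.Bool using (Bool; true; false; T; if_then_else_)
open import Data.Unit using (tt)
open import Data.Empty using (⊥; ⊥-elim)
open import Data.Fin using (Fin; _↑ˡ_; _↑ʳ_; splitAt)
open import Data.Fin.Properties using (↑ˡ-injective; ↑ʳ-injective; splitAt-↑ˡ; splitAt-↑ʳ; splitAt⁻¹-↑ˡ; splitAt⁻¹-↑ʳ)
open import Data.Sum using (_⊎_; inj₁; inj₂)
open import Data.Product using (∃₂; _×_; _,_; proj₁; proj₂)
open import Data.List using (List; []; _∷_; length; map; _++_; cartesianProduct; allFin)
open import Data.List.Properties using (length-map; length-++; length-tabulate)
open import Data.List.Membership.Propositional using (_∈_)
open import Data.List.Membership.Propositional.Properties using (∈-map⁺; ∈-map⁻; ∈-++⁺ˡ; ∈-++⁺ʳ; ∈-++⁻; ∈-cartesianProduct⁺; ∈-cartesianProduct⁻; ∈-allFin)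
open import Data.List.Relation.Unary.Unique.Propositional using (Unique)
open import Data.List.Relation.Unary.AllPairs using ([])
import Data.List.Relation.Unary.Unique.Propositional.Properties as Unique
open import Function.Bundles using (_⇔_; mk⇔; Equivalence)
open import Relation.Binary.Construct.Closure.ReflexiveTransitive using (ε; _◅_; gmap)
open import Relation.Binary.PropositionalEquality
open import Relation.Nullary using (yes; no)

length-cartesianProduct : ∀ {A B : Set} (xs : List A) (ys : List B) →
  length (cartesianProduct xs ys) ≡ length xs * length ys
length-cartesianProduct []       ys = refl
length-cartesianProduct (x ∷ xs) ys =
  trans (length-++ (map (x ,_) ys)) (cong₂ _+_ (length-map (x ,_) ys) (length-cartesianProduct xs ys))

length-allFin : ∀ n → length (allFin n) ≡ n
length-allFin n = length-tabulate (λ i → i)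

InW-complete : ∀ c → InW c (c * c)
InW-complete c =
  (λ _ _ → true) , cartesianProduct (allFin c) (allFin c)
  , Unique.cartesianProduct⁺ (Unique.allFin⁺ c) (Unique.allFin⁺ c)
  , trans (length-cartesianProduct (allFin c) (allFin c)) (cong₂ _*_ (length-allFin c) (length-allFin c))
  , λ α β → mk⇔ (λ _ → tt ◅ ε) (λ _ → ∈-cartesianProduct⁺ (∈-allFin α) (∈-allFin β))

module BlockDigraph {m n : ℕ} (E : Digraph m) (F : Digraph n) (c : Bool) where

  blockArc : Fin m ⊎ Fin n → Fin m ⊎ Fin n → Bool
  blockArc (inj₁ α) (inj₁ β) = E α β
  blockArc (inj₂ α) (inj₂ β) = F α β
  blockArc (inj₁ _) (inj₂ _) = c
  blockArc (inj₂ _) (inj₁ _) = false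

  G : Digraph (m + n)
  G i j = blockArc (splitAt m i) (splitAt m j)

  BlockReachable : Fin m ⊎ Fin n → Fin m ⊎ Fin n → Set
  BlockReachable (inj₁ α) (inj₁ β) = Reachable E α β
  BlockReachable (inj₂ α) (inj₂ β) = Reachable F α β
  BlockReachable (inj₁ _) (inj₂ _) = T c
  BlockReachable (inj₂ _) (inj₁ _) = ⊥

  BlockReachable-refl : ∀ s → BlockReachable s s
  BlockReachable-refl (inj₁ _) = ε
  BlockReachable-refl (inj₂ _) = ε

  BlockReachable-◅ : ∀ s t u → T (blockArc s t) → BlockReachable t u → BlockReachable s u
  BlockReachable-◅ (inj₁ _) (inj₁ _) (inj₁ _) p q  = p ◅ q
  BlockReachable-◅ (inj₁ _) (inj₁ _) (inj₂ _) _ q  = q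
  BlockReachable-◅ (inj₁ _) (inj₂ _) (inj₁ _) _ ()
  BlockReachable-◅ (inj₁ _) (inj₂ _) (inj₂ _) p _  = p
  BlockReachable-◅ (inj₂ _) (inj₁ _) _        () _
  BlockReachable-◅ (inj₂ _) (inj₂ _) (inj₁ _) _ ()
  BlockReachable-◅ (inj₂ _) (inj₂ _) (inj₂ _) p q  = p ◅ q

  reachable⇒blockReachable : ∀ {i j} → Reachable G i j → BlockReachable (splitAt m i) (splitAt m j)
  reachable⇒blockReachable {i} ε = BlockReachable-refl (splitAt m i)
  reachable⇒blockReachable {i} {j} (_◅_ {j = k} arc path) =
    BlockReachable-◅ (splitAt m i) (splitAt m k) (splitAt m j) arc (reachable⇒blockReachable path)

  arc-↑ˡ : ∀ α β → Arc E α β → Arc G (α ↑ˡ n) (β ↑ˡ n)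
  arc-↑ˡ α β p rewrite splitAt-↑ˡ m α n | splitAt-↑ˡ m β n = p

  arc-↑ʳ : ∀ α β → Arc F α β → Arc G (m ↑ʳ α) (m ↑ʳ β)
  arc-↑ʳ α β p rewrite splitAt-↑ʳ m n α | splitAt-↑ʳ m n β = p

  arc-↑ˡ↑ʳ : ∀ α β → T c → Arc G (α ↑ˡ n) (m ↑ʳ β)
  arc-↑ˡ↑ʳ α β p rewrite splitAt-↑ˡ m α n | splitAt-↑ʳ m n β = p

  ↑ˡ≢↑ʳ : ∀ (α : Fin m) (β : Fin n) → α ↑ˡ n ≡ m ↑ʳ β → ⊥
  ↑ˡ≢↑ʳ α β eq with trans (sym (splitAt-↑ˡ m α n)) (trans (cong (splitAt m) eq) (splitAt-↑ʳ m n β))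
  ... | ()

  pair-↑ˡ : Fin m × Fin m → Fin (m + n) × Fin (m + n)
  pair-↑ˡ (α , β) = α ↑ˡ n , β ↑ˡ n

  pair-↑ʳ : Fin n × Fin n → Fin (m + n) × Fin (m + n)
  pair-↑ʳ (α , β) = m ↑ʳ α , m ↑ʳ β

  pair-↑ˡ-injective : ∀ {x y} → pair-↑ˡ x ≡ pair-↑ˡ y → x ≡ y
  pair-↑ˡ-injective {α , β} {α' , β'} eq =
    cong₂ _,_ (↑ˡ-injective n α α' (cong proj₁ eq)) (↑ˡ-injective n β β' (cong proj₂ eq))

  pair-↑ʳ-injective : ∀ {x y} → pair-↑ʳ x ≡ pair-↑ʳ y → x ≡ y
  pair-↑ʳ-injective {α , β} {α' , β'} eq =
    cong₂ _,_ (↑ʳ-injective m α α' (cong proj₁ eq)) (↑ʳ-injective m β β' (cong proj₂ eq))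

  crossPairs : Bool → List (Fin (m + n) × Fin (m + n))
  crossPairs true  = cartesianProduct (map (_↑ˡ n) (allFin m)) (map (m ↑ʳ_) (allFin n))
  crossPairs false = []

  length-crossPairs : ∀ b → length (crossPairs b) ≡ (if b then m * n else 0)
  length-crossPairs true =
    trans (length-cartesianProduct (map (_↑ˡ n) (allFin m)) (map (m ↑ʳ_) (allFin n)))
          (cong₂ _*_ (trans (length-map _ (allFin m)) (length-allFin m))
                     (trans (length-map _ (allFin n)) (length-allFin n)))
  length-crossPairs false = refl

  crossPairs-unique : ∀ b → Unique (crossPairs b)
  crossPairs-unique true =
    Unique.cartesianProduct⁺ (Unique.map⁺ (λ {x} {y} → ↑ˡ-injective n x y) (Unique.allFin⁺ m))
                             (Unique.map⁺ (λ {x} {y} → ↑ʳ-injective m x y) (Unique.allFin⁺ n))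
  crossPairs-unique false = []

  ∈-crossPairs⁺ : ∀ b α β → T b → (α ↑ˡ n , m ↑ʳ β) ∈ crossPairs b
  ∈-crossPairs⁺ true α β _ = ∈-cartesianProduct⁺ (∈-map⁺ _ (∈-allFin α)) (∈-map⁺ _ (∈-allFin β))

  ∈-crossPairs⁻ : ∀ b {i j} → (i , j) ∈ crossPairs b →
                  T b × ∃₂ λ α β → i ≡ α ↑ˡ n × j ≡ m ↑ʳ β
  ∈-crossPairs⁻ true q with ∈-cartesianProduct⁻ (map (_↑ˡ n) (allFin m)) (map (m ↑ʳ_) (allFin n)) q
  ... | qi , qj with ∈-map⁻ (_↑ˡ n) qi | ∈-map⁻ (m ↑ʳ_) qj
  ... | α , _ , eqi | β , _ , eqj = tt , α , β , eqi , eqj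

  module _ (S₁ : List (Fin m × Fin m)) (S₂ : List (Fin n × Fin n)) where

    pairs : List (Fin (m + n) × Fin (m + n))
    pairs = map pair-↑ˡ S₁ ++ (map pair-↑ʳ S₂ ++ crossPairs c)

    length-pairs : length pairs ≡ length S₁ + length S₂ + (if c then m * n else 0)
    length-pairs = begin
      length pairs
        ≡⟨ length-++ (map pair-↑ˡ S₁) ⟩
      length (map pair-↑ˡ S₁) + length (map pair-↑ʳ S₂ ++ crossPairs c)
        ≡⟨ cong (length (map pair-↑ˡ S₁) +_) (length-++ (map pair-↑ʳ S₂)) ⟩
      length (map pair-↑ˡ S₁) + (length (map pair-↑ʳ S₂) + length (crossPairs c))
        ≡⟨ cong₂ _+_ (length-map pair-↑ˡ S₁) (cong₂ _+_ (length-map pair-↑ʳ S₂) (length-crossPairs c)) ⟩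
      length S₁ + (length S₂ + (if c then m * n else 0))
        ≡⟨ +-assoc (length S₁) _ _ ⟨
      length S₁ + length S₂ + (if c then m * n else 0) ∎
      where open ≡-Reasoning

    pairs-unique : Unique S₁ → Unique S₂ → Unique pairs
    pairs-unique u₁ u₂ =
      Unique.++⁺ (Unique.map⁺ pair-↑ˡ-injective u₁)
                 (Unique.++⁺ (Unique.map⁺ pair-↑ʳ-injective u₂) (crossPairs-unique c) right-disjoint)
                 left-disjoint
      where
      right-disjoint : ∀ {v} → v ∈ map pair-↑ʳ S₂ × v ∈ crossPairs c → ⊥
      right-disjoint (q₁ , q₂) with ∈-map⁻ pair-↑ʳ q₁
      ... | (α , _) , _ , refl with ∈-crossPairs⁻ c q₂
      ... | _ , α' , _ , eq , _ = ↑ˡ≢↑ʳ α' α (sym eq)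

      left-disjoint : ∀ {v} → v ∈ map pair-↑ˡ S₁ × v ∈ (map pair-↑ʳ S₂ ++ crossPairs c) → ⊥
      left-disjoint (q₁ , q₂) with ∈-map⁻ pair-↑ˡ q₁
      ... | (α , β) , _ , refl with ∈-++⁻ (map pair-↑ʳ S₂) q₂
      ... | inj₁ q with ∈-map⁻ pair-↑ʳ q
      ...   | (α' , _) , _ , eq = ↑ˡ≢↑ʳ α α' (cong proj₁ eq)
      left-disjoint (q₁ , q₂) | (α , β) , _ , refl | inj₂ q with ∈-crossPairs⁻ c q
      ...   | _ , _ , β' , _ , eq = ↑ˡ≢↑ʳ β β' eq

    module _ (H₁ : ∀ α β → ((α , β) ∈ S₁) ⇔ Reachable E α β)
             (H₂ : ∀ α β → ((α , β) ∈ S₂) ⇔ Reachable F α β) where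

      ∈-pairs⇒reachable : ∀ i j → (i , j) ∈ pairs → Reachable G i j
      ∈-pairs⇒reachable i j q with ∈-++⁻ (map pair-↑ˡ S₁) q
      ... | inj₁ q₁ with ∈-map⁻ pair-↑ˡ q₁
      ...   | (α , β) , r , refl = gmap (_↑ˡ n) (arc-↑ˡ _ _) (Equivalence.to (H₁ α β) r)
      ∈-pairs⇒reachable i j q | inj₂ q₂ with ∈-++⁻ (map pair-↑ʳ S₂) q₂
      ...   | inj₁ q₃ with ∈-map⁻ pair-↑ʳ q₃
      ...     | (α , β) , r , refl = gmap (m ↑ʳ_) (arc-↑ʳ _ _) (Equivalence.to (H₂ α β) r)
      ∈-pairs⇒reachable i j q | inj₂ q₂ | inj₂ q₃ with ∈-crossPairs⁻ c q₃
      ...     | p , α , β , refl , refl = arc-↑ˡ↑ʳ α β p ◅ ε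

      blockReachable⇒∈-pairs : ∀ i j → BlockReachable (splitAt m i) (splitAt m j) → (i , j) ∈ pairs
      blockReachable⇒∈-pairs i j r with splitAt m i in eqi | splitAt m j in eqj
      ... | inj₁ α | inj₁ β = subst₂ (λ x y → (x , y) ∈ pairs) (splitAt⁻¹-↑ˡ eqi) (splitAt⁻¹-↑ˡ eqj)
            (∈-++⁺ˡ (∈-map⁺ pair-↑ˡ (Equivalence.from (H₁ α β) r)))
      ... | inj₂ α | inj₂ β = subst₂ (λ x y → (x , y) ∈ pairs) (splitAt⁻¹-↑ʳ eqi) (splitAt⁻¹-↑ʳ eqj)
            (∈-++⁺ʳ (map pair-↑ˡ S₁) (∈-++⁺ˡ (∈-map⁺ pair-↑ʳ (Equivalence.from (H₂ α β) r))))
      ... | inj₁ α | inj₂ β = subst₂ (λ x y → (x , y) ∈ pairs) (splitAt⁻¹-↑ˡ eqi) (splitAt⁻¹-↑ʳ eqj)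
            (∈-++⁺ʳ (map pair-↑ˡ S₁) (∈-++⁺ʳ (map pair-↑ʳ S₂) (∈-crossPairs⁺ c α β r)))

      ∈-pairs⇔reachable : ∀ i j → ((i , j) ∈ pairs) ⇔ Reachable G i j
      ∈-pairs⇔reachable i j =
        mk⇔ (∈-pairs⇒reachable i j) (λ r → blockReachable⇒∈-pairs i j (reachable⇒blockReachable r))

InW-block : ∀ {m n k l} (c : Bool) → InW m k → InW n l →
            InW (m + n) (k + l + (if c then m * n else 0))
InW-block c (E , S₁ , u₁ , refl , H₁) (F , S₂ , u₂ , refl , H₂) =
  G , pairs S₁ S₂ , pairs-unique S₁ S₂ u₁ u₂ , length-pairs S₁ S₂ , ∈-pairs⇔reachable S₁ S₂ H₁ H₂
  where open BlockDigraph E F c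

InW-disjointUnion : ∀ {m n k l} → InW m k → InW n l → InW (m + n) (k + l)
InW-disjointUnion {k = k} {l} g h = subst (InW _) (+-identityʳ (k + l)) (InW-block false g h)

InW-join : ∀ {m n k l} → InW m k → InW n l → InW (m + n) (k + l + m * n)
InW-join = InW-block true

InW-addIsolated : ∀ {n w} → InW n w → InW (suc n) (suc w)
InW-addIsolated = InW-disjointUnion (InW-complete 1)

InW-addSource : ∀ {n w} → InW n w → InW (suc n) (suc (w + n))
InW-addSource {n} {w} g = subst (InW (suc n)) (cong (λ x → suc (w + x)) (+-identityʳ n)) (InW-join (InW-complete 1) g)

triangle : ℕ → ℕ
triangle zero    = zero
triangle (suc n) = triangle n + suc n

n≤triangle : ∀ n → n ≤ triangle n
n≤triangle zero    = z≤n
n≤triangle (suc n) = m≤n+m (suc n) (triangle n)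

n+n≤1+triangle : ∀ n → n + n ≤ suc (triangle n)
n+n≤1+triangle zero    = z≤n
n+n≤1+triangle (suc n) = s≤s (+-monoˡ-≤ (suc n) (n≤triangle n))

triangle-double : ∀ n → triangle n + triangle n ≡ n * n + n
triangle-double zero    = refl
triangle-double (suc n) = begin
  (triangle n + suc n) + (triangle n + suc n) ≡⟨ regroup (triangle n) n ⟩
  (triangle n + triangle n) + 2 * suc n       ≡⟨ cong (_+ 2 * suc n) (triangle-double n) ⟩
  (n * n + n) + 2 * suc n                     ≡⟨ expand n ⟩
  suc n * suc n + suc n                       ∎
  where
  open ≡-Reasoning
  regroup : ∀ t n → (t + suc n) + (t + suc n) ≡ (t + t) + 2 * suc n
  regroup = solve-∀
  expand : ∀ n → (n * n + n) + 2 * suc n ≡ suc n * suc n + suc n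
  expand = solve-∀

-- Adding an isolated vertex covers [n+1, b+1]; adding a source joined to
-- every vertex covers [2n+1, b+n+1]; the hypothesis makes the two overlap.
IntervalInW-suc : ∀ {n b} → n + n ≤ suc b → IntervalInW n b → IntervalInW (suc n) (b + suc n)
IntervalInW-suc {n} {b} n+n≤1+b I (suc k) (s≤s n≤k) 1+k≤b+1+n with k ≤? b
... | yes k≤b = InW-addIsolated (I k n≤k k≤b)
... | no  k≰b = subst (InW (suc n)) (cong suc (m∸n+n≡m n≤k)) (InW-addSource (I (k ∸ n) n≤k∸n k∸n≤b))
  where
  n≤k∸n : n ≤ k ∸ n
  n≤k∸n = m+n≤o⇒m≤o∸n n (≤-trans n+n≤1+b (≰⇒> k≰b))
  k∸n≤b : k ∸ n ≤ b
  k∸n≤b = m≤n+o⇒m∸n≤o k n (subst (k ≤_) (+-comm b n) (s≤s⁻¹ (subst (suc k ≤_) (+-suc b n) 1+k≤b+1+n)))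

IntervalInW-extend : ∀ {n b} → IntervalInW n b → InW n (suc b) → IntervalInW n (suc b)
IntervalInW-extend I g k n≤k k≤1+b with m≤n⇒m<n∨m≡n k≤1+b
... | inj₁ (s≤s k≤b) = I k n≤k k≤b
... | inj₂ refl      = g

IntervalInW-triangle : ∀ n → IntervalInW n (triangle n)
IntervalInW-triangle zero    zero    _ _  = InW-complete 0
IntervalInW-triangle zero    (suc k) _ ()
IntervalInW-triangle (suc n) = IntervalInW-suc (n+n≤1+triangle n) (IntervalInW-triangle n)

-- The case j = 2 is genuinely excluded: 8 is not a weight on 3 vertices.
InW-nearTriangle : ∀ j → j ≢ 2 → InW (suc j) (triangle (suc j) + j)
InW-nearTriangle 0 _ = InW-complete 1
InW-nearTriangle 1 _ = InW-complete 2
InW-nearTriangle 2 j≢2 = ⊥-elim (j≢2 refl)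
InW-nearTriangle (suc (suc (suc j))) _ with j ≟ 2
... | yes refl = InW-join (InW-complete 4) (InW-disjointUnion (InW-complete 1) (InW-complete 1))
... | no  j≢2  = subst (InW (4 + j)) (weight≡ (triangle (suc j)) j)
                       (InW-join (InW-complete 3) (InW-nearTriangle j j≢2))
  where
  weight≡ : ∀ t j → 3 * 3 + (t + j) + 3 * suc j ≡ (((t + (2 + j)) + (3 + j)) + (4 + j)) + (3 + j)
  weight≡ = solve-∀

IntervalInW-four : IntervalInW 4 13
IntervalInW-four =
  IntervalInW-extend
    (IntervalInW-extend
      (IntervalInW-extend (IntervalInW-triangle 4)
        (InW-addSource (InW-addSource (InW-complete 2))))
      (InW-join (InW-complete 2) (InW-complete 2)))
    (InW-nearTriangle 3 (λ ()))

IntervalInW-nearTriangle : ∀ i → IntervalInW (4 + i) (triangle (4 + i) + (3 + i))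
IntervalInW-nearTriangle zero    = IntervalInW-four
IntervalInW-nearTriangle (suc i) =
  subst (IntervalInW (5 + i)) top≡
    (IntervalInW-extend (IntervalInW-suc overlaps (IntervalInW-nearTriangle i))
                        (subst (InW (5 + i)) (sym top≡) (InW-nearTriangle (4 + i) (λ ()))))
  where
  shift : ∀ t i → suc (t + (3 + i) + (5 + i)) ≡ t + (5 + i) + (4 + i)
  shift = solve-∀
  top≡ : suc (triangle (4 + i) + (3 + i) + (5 + i)) ≡ triangle (5 + i) + (4 + i)
  top≡ = shift (triangle (4 + i)) i
  overlaps : (4 + i) + (4 + i) ≤ suc (triangle (4 + i) + (3 + i))
  overlaps = subst ((4 + i) + (4 + i) ≤_) (+-suc (triangle (4 + i)) (3 + i))
                  (+-monoˡ-≤ (4 + i) (n≤triangle (4 + i)))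

IsB⇒nearTriangle≤ : ∀ i {b} → IsB (4 + i) b → triangle (4 + i) + (3 + i) ≤ b
IsB⇒nearTriangle≤ i (_ , maximal) = maximal _ (IntervalInW-nearTriangle i)

[2+j]*[2+j]≤n+b : ∀ {j b n} → triangle (suc j) + j ≤ b → b ∸ suc j + 3 ≤ n →
                  suc (suc j) * suc (suc j) ≤ n + b
[2+j]*[2+j]≤n+b {j} {b} {n} t+j≤b b∸z+3≤n = +-cancelʳ-≤ z _ _ (begin
  suc z * suc z + z              ≡⟨ expand j ⟩
  (z * z + z) + (j + j + 3)      ≡⟨ cong (_+ (j + j + 3)) (triangle-double z) ⟨
  (t + t) + (j + j + 3)          ≡⟨ regroup t j ⟩
  (t + j) + (t + j) + 3          ≤⟨ +-monoˡ-≤ 3 (+-mono-≤ t+j≤b t+j≤b) ⟩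
  b + b + 3                      ≡⟨ +-assoc b b 3 ⟩
  b + (b + 3)                    ≤⟨ +-monoʳ-≤ b b+3≤n+z ⟩
  b + (n + z)                    ≡⟨ swap b n z ⟩
  n + b + z                      ∎)
  where
  open ≤-Reasoning
  z = suc j
  t = triangle z
  expand : ∀ j → suc (suc j) * suc (suc j) + suc j ≡ (suc j * suc j + suc j) + (j + j + 3)
  expand = solve-∀
  regroup : ∀ t j → (t + t) + (j + j + 3) ≡ (t + j) + (t + j) + 3
  regroup = solve-∀
  swap : ∀ b n z → b + (n + z) ≡ n + b + z
  swap = solve-∀
  z≤b : z ≤ b
  z≤b = ≤-trans (n≤triangle z) (≤-trans (m≤m+n t j) t+j≤b)
  b+3≤n+z : b + 3 ≤ n + z
  b+3≤n+z = begin
    b + 3             ≡⟨ cong (_+ 3) (m∸n+n≡m z≤b) ⟨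
    b ∸ z + z + 3     ≡⟨ +-assoc (b ∸ z) z 3 ⟩
    b ∸ z + (z + 3)   ≡⟨ cong (b ∸ z +_) (+-comm z 3) ⟩
    b ∸ z + (3 + z)   ≡⟨ +-assoc (b ∸ z) 3 z ⟨
    b ∸ z + 3 + z     ≤⟨ +-monoˡ-≤ z b∸z+3≤n ⟩
    n + z             ∎

m≤n⇒n*n+m*o≤m*m+n*o : ∀ {m n o} → m ≤ n → m + n ≤ o → n * n + m * o ≤ m * m + n * o
m≤n⇒n*n+m*o≤m*m+n*o {m} {n} {o} m≤n m+n≤o with m≤n⇒∃[o]m+o≡n m≤n
... | e , refl = begin
  (m + e) * (m + e) + m * o       ≡⟨ lhs m e o ⟩
  m * m + m * o + e * (m + (m + e)) ≤⟨ +-monoʳ-≤ (m * m + m * o) (*-monoʳ-≤ e m+n≤o) ⟩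
  m * m + m * o + e * o           ≡⟨ rhs m e o ⟩
  m * m + (m + e) * o             ∎
  where
  open ≤-Reasoning
  lhs : ∀ m e o → (m + e) * (m + e) + m * o ≡ m * m + m * o + e * (m + (m + e))
  lhs = solve-∀
  rhs : ∀ m e o → m * m + m * o + e * o ≡ m * m + (m + e) * o
  rhs = solve-∀

[1+z]*[1+z]≤n+b⇒z*n+d*d≤d*n+b : ∀ {z b n d} → suc z * suc z ≤ n + b → suc z ≤ d → suc z + d ≤ n →
                                 z * n + d * d ≤ d * n + b
[1+z]*[1+z]≤n+b⇒z*n+d*d≤d*n+b {z} {b} {n} {d} square≤ 1+z≤d 1+z+d≤n = +-cancelʳ-≤ n _ _ (begin
  z * n + d * d + n           ≡⟨ regroup z n d ⟩
  d * d + suc z * n           ≤⟨ m≤n⇒n*n+m*o≤m*m+n*o 1+z≤d 1+z+d≤n ⟩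
  suc z * suc z + d * n       ≤⟨ +-monoˡ-≤ (d * n) square≤ ⟩
  n + b + d * n               ≡⟨ swap n b (d * n) ⟩
  d * n + b + n               ∎)
  where
  open ≤-Reasoning
  regroup : ∀ z n d → z * n + d * d + n ≡ d * d + suc z * n
  regroup = solve-∀
  swap : ∀ n b x → n + b + x ≡ x + b + n
  swap = solve-∀

[m∸n]+o≤[m∸p]+q : ∀ {m n o p q} → n ≤ m → p ≤ m → p + o ≤ n + q → m ∸ n + o ≤ m ∸ p + q
[m∸n]+o≤[m∸p]+q {m} {n} {o} {p} {q} n≤m p≤m p+o≤n+q = begin
  m ∸ n + o   ≡⟨ +-∸-comm o n≤m ⟨
  m + o ∸ n   ≤⟨ m≤n+o⇒m∸n≤o (m + o) n m+o≤n+[m∸p+q] ⟩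
  m ∸ p + q   ∎
  where
  open ≤-Reasoning
  swap : ∀ r n q → r + (n + q) ≡ n + (r + q)
  swap = solve-∀
  m+o≤n+[m∸p+q] : m + o ≤ n + (m ∸ p + q)
  m+o≤n+[m∸p+q] = begin
    m + o             ≡⟨ cong (_+ o) (m∸n+n≡m p≤m) ⟨
    m ∸ p + p + o     ≡⟨ +-assoc (m ∸ p) p o ⟩
    m ∸ p + (p + o)   ≤⟨ +-monoʳ-≤ (m ∸ p) p+o≤n+q ⟩
    m ∸ p + (n + q)   ≡⟨ swap (m ∸ p) n q ⟩
    n + (m ∸ p + q)   ∎

lemma3p5 : ∀ (z b n d : ℕ) → IsB z b → 4 ≤ z → (b ∸ z) + 3 ≤ n →
    z + 1 ≤ d → 2 * d < n →
    (n * n ∸ d * n) + d * d ≤ (n * n ∸ z * n) + b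
lemma3p5 z b n d isB (s≤s (s≤s (s≤s (s≤s {n = i} _)))) b∸z+3≤n z+1≤d 2d<n =
  [m∸n]+o≤[m∸p]+q (*-monoˡ-≤ n d≤n) (*-monoˡ-≤ n (≤-trans (n≤1+n z) (≤-trans 1+z≤d d≤n)))
    ([1+z]*[1+z]≤n+b⇒z*n+d*d≤d*n+b ([2+j]*[2+j]≤n+b (IsB⇒nearTriangle≤ i isB) b∸z+3≤n) 1+z≤d 1+z+d≤n)
  where
  1+z≤d : suc z ≤ d
  1+z≤d = subst (_≤ d) (+-comm z 1) z+1≤d
  d+d≤n : d + d ≤ n
  d+d≤n = subst (_≤ n) (cong (d +_) (+-identityʳ d)) (<⇒≤ 2d<n)
  d≤n : d ≤ n
  d≤n = ≤-trans (m≤m+n d d) d+d≤n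
  1+z+d≤n : suc z + d ≤ n
  1+z+d≤n = ≤-trans (+-monoˡ-≤ d 1+z≤d) d+d≤n
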